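{- For $\xi<\omega^\eta$ define the relation $\trianglelefteq_\xi$ on $\omega$ by $s\trianglelefteq_\xi t$ iff $\nabla^\gamma_s\subseteq\nabla^\gamma_t$ for every $\gamma$ with $1\le\gamma\le\xi+1$. Then $(\trianglelefteq_\xi)_{\xi<\omega^\eta}$ is a uniformly computable sequence of reflexive transitive relations, it is nested (if $\gamma\le\xi$ and $s\trianglelefteq_\xi t$ then $s\trianglelefteq_\gamma t$), and it satisfies ($\clubsuit$): for every $\xi$ with $\xi+1<\omega^\eta$ and all $r<s<t$, if $r\trianglelefteq_{\xi+1}t$ and $s\trianglelefteq_\xi t$ then $r\trianglelefteq_{\xi+1}s$.
   Context: $\subseteq$ is the prefix relation, $\langle\rangle$ the empty string. Fix an effective enumeration $\varphi_0,\varphi_1,\dots$ of Turing functionals; for finite $\sigma$, $\varphi_e^\sigma(i)\downarrow$ means convergence with oracle $\sigma$ within $|\sigma|$ steps; strings are coded by numbers. $J:\omega^{<\omega}\to\omega^{<\omega}$: given $\sigma$, let $t_{ -1}=1$, $t_i=t_{i-1}+1$ if $\varphi_i^\sigma(i)\uparrow$, else $t_i=\max\{t_{i-1}+1,\mu t(\varphi_i^{\sigma\restriction t}(i)\downarrow)\}$; $J(\sigma)=\langle\sigma\restriction t_0,\dots,\sigma\restriction t_k\rangle$ with $k$ least such that $t_{k+1}>|\sigma|$ ($\langle\rangle$ if $t_0>|\sigma|$). $\eta$ is a computable ordinal (computable presentation, computable successor); each nonzero $\alpha\le\eta$ has a fixed uniformly computable characteristic sequence $\alpha[0]\le\alpha[1]\le\cdots<\alpha$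 with $\lim_n(\alpha[n]+1)=\alpha$. Recursively: $J^{\omega^0}=J$; for $\alpha>0$, $J^{\omega^\alpha}_n=J^{\omega^{\alpha[n-1]}}\circ\cdots\circ J^{\omega^{\alpha[0]}}$ ($J^{\omega^\alpha}_0=\mathrm{id}$), $J^{\omega^\alpha}(\sigma)=\langle J^{\omega^\alpha}_1(\sigma)(0),\dots,J^{\omega^\alpha}_{m-1}(\sigma)(0)\rangle$ with $m$ least such that $J^{\omega^\alpha}_m(\sigma)=\langle\rangle$. $T_\beta=\{\langle n_0,\dots,n_k\rangle:\beta[n_0]\cdots[n_k]\text{ exists}\}$; $J^{\omega^\beta}_{\langle\rangle}=J^{\omega^\beta}$, $J^{\omega^\beta}_{\langle n_0,\dots,n_k\rangle}=J^{\omega^{\beta[n_0]}}_{\langle n_1,\dots,n_k\rangle}\circ J^{\omega^\beta}_{n_0}$. Define $\eta\langle\rangle=\omega^\eta$ and $\eta\langle n_0,\dots,n_k\rangle=\sum_{i<n_0}\omega^{\eta[i]}+(\eta[n_0])\langle n_1,\dots,n_k\rangle$; every $\alpha$ with $1\le\alpha\le\omega^\eta$ is $\eta\langle n_0,\dots,n_k\rangle$ for a unique $\langle n_0,\dots,n_k\rangle\in T_\eta$, and ordinals $\le\omega^\eta$ are represented by these sequences. Approximations: $\nabla^1_s$ is the string of $s$ zeros, and for $\alpha=\eta\langle n_0,\dots,n_k\rangle$, $\nabla^{1+\alpha}_s=J^{\omega^\eta}_{\langle n_0,\dots,n_k\rangle}(\nabla^1_s)$. -}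

module Defs where

open import Level using (0ℓ)
open import Data.Nat using (ℕ; zero; suc; _+_; _*_; _^_; _≤_; _≤?_; _⊔_)
open import Data.Bool using (Bool; true; false; if_then_else_)
open import Data.Maybe using (Maybe; just; nothing)
open import Data.List using (List; []; _∷_; _++_; take; length; replicate; takeWhile)
open import Data.List.Relation.Binary.Prefix.Heterogeneous using (Prefix)
open import Data.Product using (Σ; ∃; ∃-syntax; _×_; _,_)
open import Data.Sum using (_⊎_)
open import Data.Unit using (⊤)
open import Function using (id; _∘_)
open import Relation.Nullary using (¬_; Dec; yes; no)
open import Relation.Nullary.Decidable using (does)
open import Relation.Binary.Core using (Rel)
open import Relation.Binary.Structures using (IsStrictTotalOrder)
open import Relation.Binary.PropositionalEquality using (_≡_; _≢_)
open import Induction.WellFounded using (WellFounded; Acc; acc)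

Str : Set
Str = List ℕ

_⊑_ : Str → Str → Set
σ ⊑ τ = Prefix _≡_ σ τ

-- A fixed coding of strings by numbers (a bijection List ℕ → ℕ):
-- ⟨⟩ ↦ 0,  x ∷ xs ↦ 2^x * (2 * code xs + 1).
code : Str → ℕ
code []       = 0
code (x ∷ xs) = 2 ^ x * (2 * code xs + 1)

-- An effective enumeration of Turing functionals.
-- φ e σ i = just v  means  φ_e^σ(i)↓ = v  (convergence with oracle σ
-- within |σ| steps).  Such step-bounded computations are monotone
-- under extension of the oracle string.

record TuringEnum : Set where
  field
    φ    : ℕ → Str → ℕ → Maybe ℕ
    mono : ∀ {e σ τ i v} → φ e σ i ≡ just v → σ ⊑ τ → φ e τ i ≡ just v

-- A computable ordinal η: a computable presentation of the ordinals ≤ η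
-- (a decidable well-founded strict total order with least element 0
-- and greatest element η), with computable successor and with
-- characteristic (fundamental) sequences α[n] for nonzero α.

record OrdPres : Set₁ where
  field
    O      : Set
    _<_    : Rel O 0ℓ
    isSTO  : IsStrictTotalOrder _≡_ _<_
    wf     : WellFounded _<_
    𝟎      : O
    𝟎-least : ∀ α → ¬ (α < 𝟎)
    η      : O
    η-top  : ∀ α → ¬ (η < α)
    succ   : O → O
    succ-> : ∀ α → α < η → α < succ α
    succ-least : ∀ α β → α < β → succ α ≡ β ⊎ succ α < β
    -- fs α n = α[n]  (only meaningful when α ≢ 𝟎)
    fs     : O → ℕ → O
    fs-mono : ∀ α n → α ≢ 𝟎 → fs α n ≡ fs α (suc n) ⊎ fs α n < fs α (suc n)
    fs-<   : ∀ α n → α ≢ 𝟎 → fs α n < α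
    -- lim_n (α[n] + 1) = α : every β < α is ≤ some α[n]
    fs-lim : ∀ α β → α ≢ 𝟎 → β < α → ∃[ n ] (β ≡ fs α n ⊎ β < fs α n)

  open IsStrictTotalOrder isSTO public using (_<?_; _≟_)

-- Ordinals < ω^(η+1) in Cantor normal form ω^{β₁}+⋯+ω^{βₖ}, β₁ ≥ ⋯ ≥ βₖ,
-- represented by the list of exponents.

module CNF (H : OrdPres) where
  open OrdPres H

  Ord : Set
  Ord = List O

  data IsCNF : Ord → Set where
    []  : IsCNF []
    [_] : ∀ x → IsCNF (x ∷ [])
    _∷_ : ∀ {x y xs} → (y ≡ x ⊎ y < x) → IsCNF (y ∷ xs) → IsCNF (x ∷ y ∷ xs)

  data _<ᶜ_ : Ord → Ord → Set where
    []<∷ : ∀ {y ys} → [] <ᶜ (y ∷ ys)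
    head< : ∀ {x y xs ys} → x < y → (x ∷ xs) <ᶜ (y ∷ ys)
    tail< : ∀ {x xs ys} → xs <ᶜ ys → (x ∷ xs) <ᶜ (x ∷ ys)

  _≤ᶜ_ : Ord → Ord → Set
  a ≤ᶜ b = a ≡ b ⊎ a <ᶜ b

  _+ᶜ_ : Ord → Ord → Ord
  a +ᶜ []      = a
  a +ᶜ (c ∷ b) = takeWhile (λ e → Relation.Nullary.¬? (e <? c)) a ++ (c ∷ b)

  ω^ : O → Ord
  ω^ β = β ∷ []

  𝟏 : Ord
  𝟏 = ω^ 𝟎

  ω^η : Ord
  ω^η = ω^ η

  InT : O → List ℕ → Set
  InT β []         = ⊤
  InT β (n ∷ rest) = β ≢ 𝟎 × InT (fs β n) rest

  sumω : O → ℕ → Ord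
  sumω β zero    = []
  sumω β (suc n) = sumω β n +ᶜ ω^ (fs β n)

  ordOf : O → List ℕ → Ord
  ordOf β []         = ω^ β
  ordOf β (n ∷ rest) = sumω β n +ᶜ ordOf (fs β n) rest

module Jump (E : TuringEnum) where
  open TuringEnum E

  conv : ℕ → Str → Bool
  conv i τ with φ i τ i
  ... | just _  = true
  ... | nothing = false

  μconv : ℕ → Str → ℕ → ℕ → Maybe ℕ
  μconv i σ k zero       = if conv i (take k σ) then just k else nothing
  μconv i σ k (suc fuel) = if conv i (take k σ) then just k else μconv i σ (suc k) fuel

  nextT : Str → ℕ → ℕ → ℕ
  nextT σ i tprev with μconv i σ 0 (length σ)
  ... | just u  = suc tprev ⊔ u
  ... | nothing = suc tprev

  -- outputs σ↾t_i, σ↾t_{i+1}, … while t ≤ |σ|  (fuel: t_i ≥ i + 2)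
  Jgo : Str → ℕ → ℕ → ℕ → List ℕ
  Jgo σ zero       i tprev = []
  Jgo σ (suc fuel) i tprev with nextT σ i tprev ≤? length σ
  ... | yes _ = code (take (nextT σ i tprev) σ) ∷ Jgo σ fuel (suc i) (nextT σ i tprev)
  ... | no  _ = []

  J : Str → Str
  J σ = Jgo σ (suc (length σ)) 0 1

  -- from the sequence n ↦ J_n(σ), build ⟨J_1(σ)(0), …, J_{m-1}(σ)(0)⟩
  -- with m least such that J_m(σ) = ⟨⟩.  Each J^{ω^α} strictly shortens
  -- nonempty strings, so m ≤ |σ| and the fuel |σ| is sufficient.
  heads : (ℕ → Str) → ℕ → ℕ → Str
  heads Jn zero       i = []
  heads Jn (suc fuel) i with Jn i
  ... | []    = []
  ... | x ∷ _ = x ∷ heads Jn fuel (suc i)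

  collect : (ℕ → Str) → Str → Str
  collect Jn []          = []
  collect Jn σ@(_ ∷ _)   = heads Jn (length σ) 1

  module _ (H : OrdPres) where
    open OrdPres H
    open CNF H

    iterJ : (ℕ → Str → Str) → ℕ → Str → Str
    iterJ F zero    = id
    iterJ F (suc n) = F n ∘ iterJ F n

    JωAcc : (α : O) → Acc _<_ α → Str → Str
    JωAcc α (acc rs) with α ≟ 𝟎
    ... | yes _  = J
    ... | no α≢0 = λ σ → collect (λ n → iterJ (λ i → JωAcc (fs α i) (rs (fs-< α i α≢0))) n σ) σ

    Jω : O → Str → Str
    Jω α = JωAcc α (wf α)

    Jωn : O → ℕ → Str → Str
    Jωn β = iterJ (λ i → Jω (fs β i))

    Jωseq : O → List ℕ → Str → Str
    Jωseq β []         = Jω β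
    Jωseq β (n ∷ rest) = Jωseq (fs β n) rest ∘ Jωn β n

    ∇¹ : ℕ → Str
    ∇¹ s = replicate s 0

    -- ∇^{1+α}_s  for α = η⟨seq⟩
    ∇ : List ℕ → ℕ → Str
    ∇ seq s = Jωseq η seq (∇¹ s)

    -- s ⊴_ξ t  iff  ∇^γ_s ⊆ ∇^γ_t for all 1 ≤ γ ≤ ξ+1.
    -- γ = 1, or γ = 1 + α with α = η⟨seq⟩, seq ∈ T_η (1 ≤ α ≤ ω^η).
    _⊴[_]_ : ℕ → Ord → ℕ → Set
    s ⊴[ ξ ] t =
      (∇¹ s ⊑ ∇¹ t) ×
      (∀ seq → InT η seq → (𝟏 +ᶜ ordOf η seq) ≤ᶜ (ξ +ᶜ 𝟏) → ∇ seq s ⊑ ∇ seq t)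

    Below : Ord → Set
    Below ξ = IsCNF ξ × ξ <ᶜ ω^η

module Submission where

-- (♣) is a sandwich argument.  If σ ⊆ ρ ⊆ τ and J(σ) ⊆ J(τ), then J(σ) ⊆ J(ρ): the first
-- entry σ↾t₀ of J(σ) is also the first entry of J(τ), so σ and τ have the same stage t₀,
-- and since stages only grow along extensions, ρ has that stage too; and so on for t₁, ….
-- The property lifts through J^{ω^β} by well-founded recursion on β, because
-- J^{ω^β}_{m+1} = J^{ω^{β[m]}} ∘ J^{ω^β}_m: if the inputs of the r-, s- and t-strings are
-- sandwiched at the node m, the r-outputs sit below the s-outputs by recursion, and the
-- s-outputs below the t-outputs by s ⊴_ξ t.  The latter applies because the level γ of the
-- node m is strictly below that of the node m+1, which is at most ξ + 2, so γ ≤ ξ + 1.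
-- Decidability holds because J^{ω^β}_n sends strings of length ≤ n to ⟨⟩, so only finitely
-- many nodes of T_η need to be checked.

open import Defs
open import Data.Bool using (Bool; true; false; if_then_else_)
open import Data.Maybe using (Maybe; just; nothing)
open import Data.Nat
  using (ℕ; zero; suc; _+_; _*_; _^_; _∸_; _⊓_; _≤_; _<_; _≤?_; _<?_; pred; z≤n; s≤s)
import Data.Nat as ℕ
open import Data.Nat.Base using (parity)
open import Data.Nat.Properties
  using (≤-refl; ≤-trans; ≤-reflexive; ≤-antisym; <-≤-trans; <⇒≤; ≮⇒≥; n≤1+n; m<n⇒n≢0;
         m∸n≢0⇒n<m; m≤n⇒m∸n≡0; m+n≤o⇒m≤o; m≤m⊔n; m≤n⇒m⊓n≡m; pred-mono-≤; pred[m∸n]≡m∸[1+n];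
         +-suc; +-comm; +-identityʳ; +-∸-assoc; ∸-monoʳ-≤; +-cancelʳ-≡; *-cancelˡ-≡; *-assoc;
         *-identityˡ; m*n≡0⇒m≡0∨n≡0; m^n≡0⇒m≡0; allUpTo?; module ≤-Reasoning)
open import Data.Parity.Base as ℙ using (0ℙ; 1ℙ)
open import Data.Parity.Properties using (+-homo-+; *-homo-*)
open import Data.List using (List; []; _∷_; _++_; take; takeWhile; length)
open import Data.List.Properties using (≡-dec; length-take)
open import Data.List.Relation.Unary.All as All using (All; []; _∷_)
open import Data.List.Relation.Unary.All.Properties using (++⁺; takeWhile⁺; all⇒takeWhile≗id)
open import Data.List.Relation.Binary.Pointwise as Pointwise using ()
open import Data.List.Relation.Binary.Prefix.Heterogeneous using ([]; _∷_)
open import Data.List.Relation.Binary.Prefix.Heterogeneous.Properties as Prefix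
  using (length-mono; prefix?; replicate⁺)
open import Data.Product using (_×_; _,_; proj₁)
open import Data.Sum using (_⊎_; inj₁; inj₂)
open import Data.Unit using (tt)
open import Relation.Nullary using (Dec; yes; no; ¬?; contradiction)
open import Relation.Nullary.Decidable using (map′; _×-dec_; _→-dec_; _⊎-dec_)
open import Relation.Unary using (Decidable)
open import Relation.Binary.Structures using (IsStrictTotalOrder)
open import Relation.Binary.Definitions using (tri<; tri≈; tri>)
open import Relation.Binary.PropositionalEquality
  using (_≡_; _≢_; refl; sym; trans; cong; subst; subst₂; module ≡-Reasoning)
open import Induction.WellFounded using (Acc; acc)

⊑-refl : ∀ {σ} → σ ⊑ σ
⊑-refl = Prefix.fromPointwise (Pointwise.refl refl)

⊑-trans : ∀ {σ ρ τ} → σ ⊑ ρ → ρ ⊑ τ → σ ⊑ τ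
⊑-trans = Prefix.trans trans

take-⊑ : ∀ {σ ρ} n → σ ⊑ ρ → n ≤ length σ → take n σ ≡ take n ρ
take-⊑ zero    _           _         = refl
take-⊑ (suc n) (refl ∷ σ⊑ρ) (s≤s n≤) = cong (_ ∷_) (take-⊑ n σ⊑ρ n≤)

take-length-≡ : ∀ {m n} (σ τ : Str) → m ≤ length σ → n ≤ length τ → take m σ ≡ take n τ → m ≡ n
take-length-≡ {m} {n} σ τ m≤ n≤ eq = begin
  m                 ≡⟨ sym (m≤n⇒m⊓n≡m m≤) ⟩
  m ⊓ length σ      ≡⟨ sym (length-take m σ) ⟩
  length (take m σ) ≡⟨ cong length eq ⟩
  length (take n τ) ≡⟨ length-take n τ ⟩
  n ⊓ length τ      ≡⟨ m≤n⇒m⊓n≡m n≤ ⟩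
  n                 ∎
  where open ≡-Reasoning

parity[2*a]≡0ℙ : ∀ a → parity (2 * a) ≡ 0ℙ
parity[2*a]≡0ℙ = *-homo-* 2

parity[2*a+1]≡1ℙ : ∀ a → parity (2 * a + 1) ≡ 1ℙ
parity[2*a+1]≡1ℙ a = trans (+-homo-+ (2 * a) 1) (cong (ℙ._+ 1ℙ) (parity[2*a]≡0ℙ a))

2*a+1≢2*b : ∀ a b → 2 * a + 1 ≢ 2 * b
2*a+1≢2*b a b eq
  with trans (sym (parity[2*a+1]≡1ℙ a)) (trans (cong parity eq) (parity[2*a]≡0ℙ b))
... | ()

2^x*[2a+1]-injective : ∀ x y a b → 2 ^ x * (2 * a + 1) ≡ 2 ^ y * (2 * b + 1) → x ≡ y × a ≡ b
2^x*[2a+1]-injective zero zero a b eq =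
  refl , *-cancelˡ-≡ a b 2 (+-cancelʳ-≡ 1 (2 * a) (2 * b) (*-cancelˡ-≡ _ _ 1 eq))
2^x*[2a+1]-injective zero (suc y) a b eq =
  contradiction (trans (sym (*-identityˡ _)) (trans eq (*-assoc 2 (2 ^ y) _)))
                (2*a+1≢2*b a (2 ^ y * (2 * b + 1)))
2^x*[2a+1]-injective (suc x) zero a b eq =
  contradiction (trans (sym (*-identityˡ _)) (trans (sym eq) (*-assoc 2 (2 ^ x) _)))
                (2*a+1≢2*b b (2 ^ x * (2 * a + 1)))
2^x*[2a+1]-injective (suc x) (suc y) a b eq
  with 2^x*[2a+1]-injective x y a b
         (*-cancelˡ-≡ _ _ 2 (trans (sym (*-assoc 2 (2 ^ x) _)) (trans eq (*-assoc 2 (2 ^ y) _))))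
... | refl , a≡b = refl , a≡b

code[x∷xs]≢0 : ∀ x xs → code (x ∷ xs) ≢ 0
code[x∷xs]≢0 x xs eq with m*n≡0⇒m≡0∨n≡0 (2 ^ x) eq
... | inj₂ odd≡0 = 2*a+1≢2*b (code xs) 0 odd≡0
... | inj₁ 2^x≡0 with m^n≡0⇒m≡0 2 x 2^x≡0
...   | ()

code-injective : ∀ σ τ → code σ ≡ code τ → σ ≡ τ
code-injective []      []      _  = refl
code-injective []      (y ∷ τ) eq = contradiction (sym eq) (code[x∷xs]≢0 y τ)
code-injective (x ∷ σ) []      eq = contradiction eq (code[x∷xs]≢0 x σ)
code-injective (x ∷ σ) (y ∷ τ) eq with 2^x*[2a+1]-injective x y (code σ) (code τ) eq
... | refl , codes≡ = cong (x ∷_) (code-injective σ τ codes≡)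

Shrinking : (Str → Str) → Set
Shrinking F = ∀ σ → length (F σ) ≤ pred (length σ)

suc[m∸1+n]≡m∸n : ∀ {m n} → n < m → suc (m ∸ suc n) ≡ m ∸ n
suc[m∸1+n]≡m∸n n<m = sym (+-∸-assoc 1 n<m)

length≤0⇒≡[] : ∀ {σ : Str} → length σ ≤ 0 → σ ≡ []
length≤0⇒≡[] {[]} _ = refl

module CantorNormalForm (H : OrdPres) where
  open OrdPres H renaming (_<_ to _≺_; _<?_ to _≺?_)
  open CNF H

  private
    ≺-trans : ∀ {a b c} → a ≺ b → b ≺ c → a ≺ c
    ≺-trans = IsStrictTotalOrder.trans isSTO

    𝟎-minimum : ∀ a → 𝟎 ≡ a ⊎ 𝟎 ≺ a
    𝟎-minimum a with IsStrictTotalOrder.compare isSTO 𝟎 a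
    ... | tri< 𝟎<a _ _ = inj₂ 𝟎<a
    ... | tri≈ _ 𝟎≡a _ = inj₁ 𝟎≡a
    ... | tri> _ _ a<𝟎 = contradiction a<𝟎 (𝟎-least a)

    -- the part of a that survives in a +ᶜ (c ∷ b)
    keep : O → Ord → Ord
    keep c = takeWhile (λ e → ¬? (e ≺? c))

  <ᶜ-trans : ∀ {x y z} → x <ᶜ y → y <ᶜ z → x <ᶜ z
  <ᶜ-trans []<∷       (head< _)   = []<∷
  <ᶜ-trans []<∷       (tail< _)   = []<∷
  <ᶜ-trans (head< p)  (head< q)   = head< (≺-trans p q)
  <ᶜ-trans (head< p)  (tail< _)   = head< p
  <ᶜ-trans (tail< _)  (head< q)   = head< q
  <ᶜ-trans (tail< p)  (tail< q)   = tail< (<ᶜ-trans p q)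

  <-≤ᶜ-trans : ∀ {x y z} → x <ᶜ y → y ≤ᶜ z → x <ᶜ z
  <-≤ᶜ-trans x<y (inj₁ refl) = x<y
  <-≤ᶜ-trans x<y (inj₂ y<z)  = <ᶜ-trans x<y y<z

  ≤ᶜ-trans : ∀ {x y z} → x ≤ᶜ y → y ≤ᶜ z → x ≤ᶜ z
  ≤ᶜ-trans (inj₁ refl) y≤z = y≤z
  ≤ᶜ-trans (inj₂ x<y)  y≤z = inj₂ (<-≤ᶜ-trans x<y y≤z)

  <ᶜ? : ∀ x y → Dec (x <ᶜ y)
  <ᶜ? x        []       = no λ ()
  <ᶜ? []       (y ∷ ys) = yes []<∷
  <ᶜ? (x ∷ xs) (y ∷ ys) with x ≺? y | x ≟ y | <ᶜ? xs ys
  ... | yes x<y | _       | _        = yes (head< x<y)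
  ... | no x≮y  | yes refl | yes xs<ys = yes (tail< xs<ys)
  ... | no x≮y  | yes refl | no xs≮ys  =
    no λ { (head< x<x) → x≮y x<x ; (tail< xs<ys) → xs≮ys xs<ys }
  ... | no x≮y  | no x≢y   | _         = no λ { (head< x<y) → x≮y x<y ; (tail< _) → x≢y refl }

  ≤ᶜ? : ∀ x y → Dec (x ≤ᶜ y)
  ≤ᶜ? x y = ≡-dec _≟_ x y ⊎-dec <ᶜ? x y

  []<ᶜ-++∷ : ∀ p c b → [] <ᶜ (p ++ c ∷ b)
  []<ᶜ-++∷ []      c b = []<∷
  []<ᶜ-++∷ (_ ∷ _) c b = []<∷

  ++-monoʳ-<ᶜ : ∀ p {x y} → x <ᶜ y → (p ++ x) <ᶜ (p ++ y)
  ++-monoʳ-<ᶜ []      x<y = x<y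
  ++-monoʳ-<ᶜ (e ∷ p) x<y = tail< (++-monoʳ-<ᶜ p x<y)

  +ᶜ-monoʳ-<ᶜ : ∀ a {x y} → x <ᶜ y → (a +ᶜ x) <ᶜ (a +ᶜ y)
  +ᶜ-monoʳ-<ᶜ a ([]<∷ {c} {b}) = <keep c b a
    where
    <keep : ∀ c b a → a <ᶜ (keep c a ++ c ∷ b)
    <keep c b []      = []<∷
    <keep c b (e ∷ a) with e ≺? c
    ... | yes e<c = head< e<c
    ... | no  _   = tail< (<keep c b a)
  +ᶜ-monoʳ-<ᶜ a (head< {xs = x} {ys = y} c<d) = keep-< a c<d
    where
    keep-< : ∀ a {c d} → c ≺ d → (keep c a ++ c ∷ x) <ᶜ (keep d a ++ d ∷ y)
    keep-< []      c<d = head< c<d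
    keep-< (e ∷ a) {c} {d} c<d with e ≺? c | e ≺? d
    ... | yes _   | yes _   = head< c<d
    ... | yes e<c | no  e≮d = contradiction (≺-trans e<c c<d) e≮d
    ... | no  _   | yes e<d = head< e<d
    ... | no  _   | no  _   = tail< (keep-< a c<d)
  +ᶜ-monoʳ-<ᶜ a (tail< {x = c} x<y) = ++-monoʳ-<ᶜ (keep c a) (tail< x<y)

  []<ᶜ+ᶜ : ∀ a {x} → [] <ᶜ x → [] <ᶜ (a +ᶜ x)
  []<ᶜ+ᶜ a ([]<∷ {c} {b}) = []<ᶜ-++∷ (keep c a) c b

  +𝟏≡++𝟎 : ∀ w → w +ᶜ 𝟏 ≡ w ++ 𝟎 ∷ []
  +𝟏≡++𝟎 w = cong (_++ 𝟎 ∷ []) (all⇒takeWhile≗id _ (All.universal 𝟎-least w))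

  <ᶜ+𝟏 : ∀ w → w <ᶜ (w +ᶜ 𝟏)
  <ᶜ+𝟏 w = +ᶜ-monoʳ-<ᶜ w []<∷

  <ᶜ++𝟎⇒≤ᶜ : ∀ {x} w → x <ᶜ (w ++ 𝟎 ∷ []) → x ≤ᶜ w
  <ᶜ++𝟎⇒≤ᶜ []      []<∷         = inj₁ refl
  <ᶜ++𝟎⇒≤ᶜ []      (head< a<𝟎)  = contradiction a<𝟎 (𝟎-least _)
  <ᶜ++𝟎⇒≤ᶜ (c ∷ w) []<∷         = inj₂ []<∷
  <ᶜ++𝟎⇒≤ᶜ (c ∷ w) (head< a<c)  = inj₂ (head< a<c)
  <ᶜ++𝟎⇒≤ᶜ (c ∷ w) (tail< x<w𝟎) with <ᶜ++𝟎⇒≤ᶜ w x<w𝟎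
  ... | inj₁ refl = inj₁ refl
  ... | inj₂ x<w  = inj₂ (tail< x<w)

  <ᶜ+𝟏⇒≤ᶜ : ∀ {x} w → x <ᶜ (w +ᶜ 𝟏) → x ≤ᶜ w
  <ᶜ+𝟏⇒≤ᶜ w x<w+1 = <ᶜ++𝟎⇒≤ᶜ w (subst₂ _<ᶜ_ refl (+𝟏≡++𝟎 w) x<w+1)

  ++𝟎-mono-<ᶜ : ∀ {x y} → x <ᶜ y → (x ++ 𝟎 ∷ []) <ᶜ (y ++ 𝟎 ∷ [])
  ++𝟎-mono-<ᶜ ([]<∷ {c} {b}) with 𝟎-minimum c
  ... | inj₁ refl = tail< ([]<ᶜ-++∷ b 𝟎 [])
  ... | inj₂ 𝟎<c  = head< 𝟎<c
  ++𝟎-mono-<ᶜ (head< c<d)  = head< c<d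
  ++𝟎-mono-<ᶜ (tail< x<y)  = tail< (++𝟎-mono-<ᶜ x<y)

  +𝟏-mono-≤ᶜ : ∀ {x y} → x ≤ᶜ y → (x +ᶜ 𝟏) ≤ᶜ (y +ᶜ 𝟏)
  +𝟏-mono-≤ᶜ         (inj₁ refl) = inj₁ refl
  +𝟏-mono-≤ᶜ {x} {y} (inj₂ x<y)  =
    inj₂ (subst₂ _<ᶜ_ (sym (+𝟏≡++𝟎 x)) (sym (+𝟏≡++𝟎 y)) (++𝟎-mono-<ᶜ x<y))

  descend : O → List ℕ → O
  descend β []      = β
  descend β (n ∷ p) = descend (fs β n) p

  []<ᶜordOf : ∀ β seq → [] <ᶜ ordOf β seq
  []<ᶜordOf β []      = []<∷
  []<ᶜordOf β (n ∷ p) = []<ᶜ+ᶜ (sumω β n) ([]<ᶜordOf (fs β n) p)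

  sumω-exponents< : ∀ β → β ≢ 𝟎 → ∀ n → All (_≺ β) (sumω β n)
  sumω-exponents< β β≢𝟎 zero    = []
  sumω-exponents< β β≢𝟎 (suc n) = ++⁺ (takeWhile⁺ _ (sumω-exponents< β β≢𝟎 n)) (fs-< β n β≢𝟎 ∷ [])

  exponents<⇒<ᶜω^ : ∀ {β x} → All (_≺ β) x → x <ᶜ ω^ β
  exponents<⇒<ᶜω^ []          = []<∷
  exponents<⇒<ᶜω^ (e<β ∷ _)   = head< e<β

  ordOf-extend-<ᶜ : ∀ β p i → descend β p ≢ 𝟎 → ordOf β (p ++ i ∷ []) <ᶜ ordOf β p
  ordOf-extend-<ᶜ β []      i β≢𝟎 = exponents<⇒<ᶜω^ (sumω-exponents< β β≢𝟎 (suc i))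
  ordOf-extend-<ᶜ β (n ∷ p) i ≢𝟎  = +ᶜ-monoʳ-<ᶜ (sumω β n) (ordOf-extend-<ᶜ (fs β n) p i ≢𝟎)

  ordOf-sibling-<ᶜ : ∀ β p m rest → ordOf β (p ++ m ∷ []) <ᶜ ordOf β (p ++ suc m ∷ rest)
  ordOf-sibling-<ᶜ β []      m rest = +ᶜ-monoʳ-<ᶜ (sumω β (suc m)) ([]<ᶜordOf (fs β (suc m)) rest)
  ordOf-sibling-<ᶜ β (n ∷ p) m rest = +ᶜ-monoʳ-<ᶜ (sumω β n) (ordOf-sibling-<ᶜ (fs β n) p m rest)

  -- Bd and Bd' abstract the sets {seq ∣ 1 + β⟨seq⟩ ≤ w + 1} and {seq ∣ 1 + β⟨seq⟩ ≤ w}.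
  record SegmentPair (β : O) (Bd Bd' : List ℕ → Set) : Set where
    field
      extend  : ∀ p i → descend β p ≢ 𝟎 → Bd p → Bd (p ++ i ∷ [])
      sibling : ∀ p m rest → Bd (p ++ suc m ∷ rest) → Bd' (p ++ m ∷ [])
      weaken  : ∀ {p} → Bd' p → Bd p

  SegmentPair-child : ∀ {β Bd Bd'} → SegmentPair β Bd Bd' → ∀ n →
                      SegmentPair (fs β n) (λ p → Bd (n ∷ p)) (λ p → Bd' (n ∷ p))
  SegmentPair-child seg n = record
    { extend  = λ p → extend (n ∷ p)
    ; sibling = λ p → sibling (n ∷ p)
    ; weaken  = weaken
    }
    where open SegmentPair seg

  ordinalSegments : ∀ β w → SegmentPair β (λ seq → (𝟏 +ᶜ ordOf β seq) ≤ᶜ (w +ᶜ 𝟏))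
                                          (λ seq → (𝟏 +ᶜ ordOf β seq) ≤ᶜ w)
  ordinalSegments β w = record
    { extend  = λ p i ≢𝟎 bd → inj₂ (<-≤ᶜ-trans (+ᶜ-monoʳ-<ᶜ 𝟏 (ordOf-extend-<ᶜ β p i ≢𝟎)) bd)
    ; sibling = λ p m rest bd →
        <ᶜ+𝟏⇒≤ᶜ w (<-≤ᶜ-trans (+ᶜ-monoʳ-<ᶜ 𝟏 (ordOf-sibling-<ᶜ β p m rest)) bd)
    ; weaken  = λ bd → ≤ᶜ-trans bd (inj₂ (<ᶜ+𝟏 w))
    }

module JumpProperties (E : TuringEnum) where
  open Jump E

  a<nextT : ∀ σ i a → a < nextT σ i a
  a<nextT σ i a with μconv i σ 0 (length σ)
  ... | just u  = m≤m⊔n (suc a) u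
  ... | nothing = ≤-refl

  Jgo-length : ∀ σ f i a → length (Jgo σ f i a) ≤ length σ ∸ a
  Jgo-length σ zero    i a = z≤n
  Jgo-length σ (suc f) i a with nextT σ i a ≤? length σ
  ... | no  _   = z≤n
  ... | yes t≤  = begin
    suc (length (Jgo σ f (suc i) (nextT σ i a))) ≤⟨ s≤s (Jgo-length σ f (suc i) (nextT σ i a)) ⟩
    suc (length σ ∸ nextT σ i a)                 ≤⟨ s≤s (∸-monoʳ-≤ (length σ) (a<nextT σ i a)) ⟩
    suc (length σ ∸ suc a)                       ≡⟨ suc[m∸1+n]≡m∸n (<-≤-trans (a<nextT σ i a) t≤) ⟩
    length σ ∸ a                                 ∎
    where open ≤-Reasoning

  J-shrinking : Shrinking J
  J-shrinking σ = ≤-trans (Jgo-length σ (suc (length σ)) 0 1)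
                          (≤-reflexive (sym (pred[m∸n]≡m∸[1+n] (length σ) 0)))

  if-just-transfer : ∀ {b b' : Bool} {k u} {m m' : Maybe ℕ} → b ≡ b' → (m ≡ just u → m' ≡ just u) →
                     (if b then just k else m) ≡ just u → (if b' then just k else m') ≡ just u
  if-just-transfer {true}  refl _    found = found
  if-just-transfer {false} refl next found = next found

  μconv-⊑ : ∀ i {σ ρ} k f f' {u} → σ ⊑ ρ → k + f ≤ length σ → f ≤ f' →
            μconv i σ k f ≡ just u → μconv i ρ k f' ≡ just u
  μconv-⊑ i k zero    zero     σ⊑ρ k≤ _ =
    if-just-transfer (cong (conv i) (take-⊑ k σ⊑ρ (m+n≤o⇒m≤o k k≤))) λ ()
  μconv-⊑ i k zero    (suc f') σ⊑ρ k≤ _ =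
    if-just-transfer (cong (conv i) (take-⊑ k σ⊑ρ (m+n≤o⇒m≤o k k≤))) λ ()
  μconv-⊑ i {σ} k (suc f) (suc f') σ⊑ρ k+f≤ (s≤s f≤f') =
    if-just-transfer (cong (conv i) (take-⊑ k σ⊑ρ (m+n≤o⇒m≤o k k+f≤)))
      (μconv-⊑ i (suc k) f f' σ⊑ρ (subst (_≤ length σ) (+-suc k f) k+f≤) f≤f')

  nextT-mono : ∀ {σ ρ} i a → σ ⊑ ρ → nextT σ i a ≤ nextT ρ i a
  nextT-mono {σ} {ρ} i a σ⊑ρ with μconv i σ 0 (length σ) in found
  ... | nothing = a<nextT ρ i a
  ... | just u rewrite μconv-⊑ i 0 (length σ) (length ρ) σ⊑ρ ≤-refl (length-mono σ⊑ρ) found = ≤-refl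

  nextT-squeeze : ∀ {σ ρ τ} i a → σ ⊑ ρ → ρ ⊑ τ → nextT σ i a ≤ length σ → nextT τ i a ≤ length τ →
                  code (take (nextT σ i a) σ) ≡ code (take (nextT τ i a) τ) →
                  nextT σ i a ≡ nextT τ i a × nextT ρ i a ≡ nextT σ i a
  nextT-squeeze {σ} {ρ} {τ} i a σ⊑ρ ρ⊑τ tσ≤ tτ≤ codes≡ = tσ≡tτ , tρ≡tσ
    where
    tσ≡tτ : nextT σ i a ≡ nextT τ i a
    tσ≡tτ = take-length-≡ σ τ tσ≤ tτ≤ (code-injective _ _ codes≡)
    tρ≡tσ : nextT ρ i a ≡ nextT σ i a
    tρ≡tσ = ≤-antisym (subst (nextT ρ i a ≤_) (sym tσ≡tτ) (nextT-mono i a ρ⊑τ)) (nextT-mono i a σ⊑ρ)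

  Jgo-sandwich : ∀ {σ ρ τ} fσ fρ fτ i a → σ ⊑ ρ → ρ ⊑ τ → fσ ≤ fρ →
                 Jgo σ fσ i a ⊑ Jgo τ fτ i a → Jgo σ fσ i a ⊑ Jgo ρ fρ i a
  Jgo-sandwich zero _ _ i a _ _ _ _ = []
  Jgo-sandwich {σ} {ρ} {τ} (suc f) (suc g) fτ i a σ⊑ρ ρ⊑τ (s≤s f≤g) σ≼τ with nextT σ i a ≤? length σ
  ... | no _ = []
  ... | yes tσ≤ with fτ | σ≼τ
  ...   | zero | ()
  ...   | suc fτ | σ≼τ with nextT τ i a ≤? length τ | σ≼τ
  ...     | no _ | ()
  ...     | yes tτ≤ | codes≡ ∷ rest≼
        with nextT-squeeze i a σ⊑ρ ρ⊑τ tσ≤ tτ≤ codes≡ | nextT ρ i a ≤? length ρ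
  ...     | _ , tρ≡tσ | no tρ≰ =
              contradiction (subst (_≤ length ρ) (sym tρ≡tσ) (≤-trans tσ≤ (length-mono σ⊑ρ))) tρ≰
  ...     | tσ≡tτ , tρ≡tσ | yes _ rewrite tρ≡tσ =
              cong code (take-⊑ _ σ⊑ρ tσ≤)
              ∷ Jgo-sandwich f g fτ (suc i) _ σ⊑ρ ρ⊑τ f≤g
                  (subst (λ t → Jgo σ f (suc i) _ ⊑ Jgo τ fτ (suc i) t) (sym tσ≡tτ) rest≼)

  J-sandwich : ∀ {σ ρ τ} → σ ⊑ ρ → ρ ⊑ τ → J σ ⊑ J τ → J σ ⊑ J ρ
  J-sandwich σ⊑ρ ρ⊑τ = Jgo-sandwich _ _ _ 0 1 σ⊑ρ ρ⊑τ (s≤s (length-mono σ⊑ρ))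

module Hierarchy (E : TuringEnum) (H : OrdPres) where
  open OrdPres H using (O; 𝟎; fs; fs-<; wf; _≟_) renaming (_<_ to _≺_)
  open CNF H
  open Jump E
  open JumpProperties E
  open CantorNormalForm H

  iterJ-length : ∀ {F} → (∀ i → Shrinking (F i)) → ∀ n σ → length (iterJ H F n σ) ≤ length σ ∸ n
  iterJ-length     F-shrinks zero    σ = ≤-refl
  iterJ-length {F} F-shrinks (suc n) σ = begin
    length (F n (iterJ H F n σ))  ≤⟨ F-shrinks n (iterJ H F n σ) ⟩
    pred (length (iterJ H F n σ)) ≤⟨ pred-mono-≤ (iterJ-length F-shrinks n σ) ⟩
    pred (length σ ∸ n)           ≡⟨ pred[m∸n]≡m∸[1+n] (length σ) n ⟩
    length σ ∸ suc n              ∎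
    where open ≤-Reasoning

  heads-length : ∀ X L → (∀ j → length (X j) ≤ L ∸ j) → ∀ f i → length (heads X f i) ≤ L ∸ i
  heads-length X L X-short zero    i = z≤n
  heads-length X L X-short (suc f) i with X i | X-short i
  ... | []    | _     = z≤n
  ... | _ ∷ _ | Xi≤   = begin
    suc (length (heads X f (suc i))) ≤⟨ s≤s (heads-length X L X-short f (suc i)) ⟩
    suc (L ∸ suc i)                  ≡⟨ suc[m∸1+n]≡m∸n (m∸n≢0⇒n<m {L} {i} (m<n⇒n≢0 Xi≤)) ⟩
    L ∸ i                            ∎
    where open ≤-Reasoning

  collect-shrinking : ∀ X σ → (∀ j → length (X j) ≤ length σ ∸ j) →
                      length (collect X σ) ≤ pred (length σ)
  collect-shrinking X []      _       = z≤n
  collect-shrinking X (_ ∷ σ) X-short = heads-length X _ X-short (suc (length σ)) 1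

  JωAcc-shrinking : ∀ α (a : Acc _≺_ α) → Shrinking (JωAcc H α a)
  JωAcc-shrinking α (acc rs) σ with α ≟ 𝟎
  ... | yes _   = J-shrinking σ
  ... | no α≢𝟎 = collect-shrinking _ σ λ j →
                    iterJ-length (λ i → JωAcc-shrinking (fs α i) (rs (fs-< α i α≢𝟎))) j σ

  Jω-shrinking : ∀ α → Shrinking (Jω H α)
  Jω-shrinking α = JωAcc-shrinking α (wf α)

  Jωn-exhausted : ∀ β n σ → length σ ≤ n → Jωn H β n σ ≡ []
  Jωn-exhausted β n σ |σ|≤n = length≤0⇒≡[] (≤-trans
    (iterJ-length (λ i → Jω-shrinking (fs β i)) n σ) (≤-reflexive (m≤n⇒m∸n≡0 |σ|≤n)))

  Jωseq-[] : ∀ β rest → Jωseq H β rest [] ≡ []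
  Jωseq-[] β []         = length≤0⇒≡[] (Jω-shrinking β [])
  Jωseq-[] β (n ∷ rest) rewrite Jωn-exhausted β n [] z≤n = Jωseq-[] (fs β n) rest

  iterJ-cong : ∀ {F G} → (∀ i σ → F i σ ≡ G i σ) → ∀ n σ → iterJ H F n σ ≡ iterJ H G n σ
  iterJ-cong         F≗G zero    σ = refl
  iterJ-cong {F} {G} F≗G (suc n) σ = trans (cong (F n) (iterJ-cong F≗G n σ)) (F≗G n _)

  heads-cong : ∀ {X Y} → (∀ j → X j ≡ Y j) → ∀ f i → heads X f i ≡ heads Y f i
  heads-cong         X≗Y zero    i = refl
  heads-cong {X} {Y} X≗Y (suc f) i with X i | Y i | X≗Y i
  ... | []    | _ | refl = refl
  ... | x ∷ _ | _ | refl = cong (x ∷_) (heads-cong X≗Y f (suc i))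

  collect-cong : ∀ {X Y} → (∀ j → X j ≡ Y j) → ∀ σ → collect X σ ≡ collect Y σ
  collect-cong X≗Y []      = refl
  collect-cong X≗Y (_ ∷ σ) = heads-cong X≗Y _ 1

  JωAcc-irrelevant : ∀ α (a b : Acc _≺_ α) σ → JωAcc H α a σ ≡ JωAcc H α b σ
  JωAcc-irrelevant α (acc rs) (acc rs') σ with α ≟ 𝟎
  ... | yes _   = refl
  ... | no α≢𝟎 = collect-cong (λ n → iterJ-cong (λ i → JωAcc-irrelevant (fs α i)
                    (rs (fs-< α i α≢𝟎)) (rs' (fs-< α i α≢𝟎))) n σ) σ

  Jω-𝟎 : ∀ {β} → β ≡ 𝟎 → ∀ σ → Jω H β σ ≡ J σ
  Jω-𝟎 refl σ with wf 𝟎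
  ... | acc _ with 𝟎 ≟ 𝟎
  ...   | yes _   = refl
  ...   | no 𝟎≢𝟎 = contradiction refl 𝟎≢𝟎

  Jω-limit : ∀ β → β ≢ 𝟎 → ∀ σ → Jω H β σ ≡ collect (λ n → Jωn H β n σ) σ
  Jω-limit β β≢𝟎 σ with wf β
  ... | acc rs with β ≟ 𝟎
  ...   | yes β≡𝟎 = contradiction β≡𝟎 β≢𝟎
  ...   | no β≢𝟎′ = collect-cong (λ n → iterJ-cong (λ i → JωAcc-irrelevant (fs β i)
                       (rs (fs-< β i β≢𝟎′)) (wf (fs β i))) n σ) σ

  heads-⊑ : ∀ {X Y} → (∀ j → X j ⊑ Y j) → ∀ f i → heads X f i ⊑ heads Y f i
  heads-⊑         X⊑Y zero    i = []
  heads-⊑ {X} {Y} X⊑Y (suc f) i with X i | Y i | X⊑Y i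
  ... | []    | _     | []       = []
  ... | x ∷ _ | _ ∷ _ | refl ∷ _ = refl ∷ heads-⊑ X⊑Y f (suc i)

  heads-stable : ∀ X f i k → X (i + f) ≡ [] → heads X (f + k) i ≡ heads X f i
  heads-stable X zero    i k Xi≡[] = heads-[] k (trans (cong X (sym (+-identityʳ i))) Xi≡[])
    where
    heads-[] : ∀ f → X i ≡ [] → heads X f i ≡ []
    heads-[] zero    _     = refl
    heads-[] (suc f) Xi≡[] with X i | Xi≡[]
    ... | _ | refl = refl
  heads-stable X (suc f) i k Xi+f≡[] with X i
  ... | []    = refl
  ... | x ∷ _ = cong (x ∷_) (heads-stable X f (suc i) k (trans (cong X (sym (+-suc i f))) Xi+f≡[]))

  collect-⊑ : ∀ {X Y σ τ} → (∀ j → X j ⊑ Y j) → σ ⊑ τ →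
              (∀ j → length σ ≤ j → X j ≡ []) → (∀ j → length τ ≤ j → Y j ≡ []) →
              collect X σ ⊑ collect Y τ
  collect-⊑ {σ = []} _ _ _ _ = []
  collect-⊑ {X} {Y} {σ = _ ∷ σ} {τ = _ ∷ τ} X⊑Y _ X-vanishes Y-vanishes =
    subst₂ _⊑_ (heads-stable X (suc (length σ)) 1 (suc (length τ)) (X-vanishes _ (n≤1+n _)))
               (trans (cong (λ f → heads Y f 1) (+-comm (suc (length σ)) (suc (length τ))))
                      (heads-stable Y (suc (length τ)) 1 (suc (length σ)) (Y-vanishes _ (n≤1+n _))))
               (heads-⊑ X⊑Y (suc (length σ) + suc (length τ)) 1)

  Jω-limit-⊑ : ∀ β → β ≢ 𝟎 → ∀ {σ τ} → σ ⊑ τ → (∀ n → Jωn H β n σ ⊑ Jωn H β n τ) →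
               Jω H β σ ⊑ Jω H β τ
  Jω-limit-⊑ β β≢𝟎 {σ} {τ} σ⊑τ iterates⊑ =
    subst₂ _⊑_ (sym (Jω-limit β β≢𝟎 σ)) (sym (Jω-limit β β≢𝟎 τ))
      (collect-⊑ iterates⊑ σ⊑τ (λ j → Jωn-exhausted β j σ) (λ j → Jωn-exhausted β j τ))

  Jω𝟎-sandwich : ∀ {β σ ρ τ} → β ≡ 𝟎 → σ ⊑ ρ → ρ ⊑ τ →
                 Jω H β σ ⊑ Jω H β τ → Jω H β σ ⊑ Jω H β ρ
  Jω𝟎-sandwich {σ = σ} {ρ} {τ} β≡𝟎 σ⊑ρ ρ⊑τ
    rewrite Jω-𝟎 β≡𝟎 σ | Jω-𝟎 β≡𝟎 ρ | Jω-𝟎 β≡𝟎 τ = J-sandwich σ⊑ρ ρ⊑τ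

  _⊑⟨_∣_⟩_ : Str → O → (List ℕ → Set) → Str → Set
  σ ⊑⟨ β ∣ Bd ⟩ τ = ∀ seq → InT β seq → Bd seq → Jωseq H β seq σ ⊑ Jωseq H β seq τ

  -- Only the finitely many children n < |σ| matter: the others receive the empty string.
  ⊑⟨⟩? : ∀ β → Acc _≺_ β → ∀ {Bd} → Decidable Bd → ∀ σ τ → Dec (σ ⊑⟨ β ∣ Bd ⟩ τ)
  ⊑⟨⟩? β (acc rs) {Bd} Bd? σ τ =
    map′ combine split ((Bd? [] →-dec prefix? ℕ._≟_ (Jω H β σ) (Jω H β τ)) ×-dec children?)
    where
    Child : ℕ → Set
    Child n = Jωn H β n σ ⊑⟨ fs β n ∣ (λ p → Bd (n ∷ p)) ⟩ Jωn H β n τ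

    exhausted-child : ∀ n → length σ ≤ n → Child n
    exhausted-child n |σ|≤n seq _ _ rewrite Jωn-exhausted β n σ |σ|≤n | Jωseq-[] (fs β n) seq = []

    children? : Dec (β ≢ 𝟎 → ∀ n → Child n)
    children? with β ≟ 𝟎
    ... | yes β≡𝟎 = yes λ β≢𝟎 → contradiction β≡𝟎 β≢𝟎
    ... | no β≢𝟎  = map′ every (λ all {n} _ → all β≢𝟎 n)
                      (allUpTo? (λ n → ⊑⟨⟩? (fs β n) (rs (fs-< β n β≢𝟎)) (λ p → Bd? (n ∷ p)) _ _)
                                (length σ))
      where
      every : (∀ {n} → n < length σ → Child n) → β ≢ 𝟎 → ∀ n → Child n
      every below _ n with n <? length σ
      ... | yes n<|σ| = below n<|σ|
      ... | no  n≮|σ| = exhausted-child n (≮⇒≥ n≮|σ|)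

    combine : (Bd [] → Jω H β σ ⊑ Jω H β τ) × (β ≢ 𝟎 → ∀ n → Child n) → σ ⊑⟨ β ∣ Bd ⟩ τ
    combine (root , children) []        _          bd = root bd
    combine (root , children) (n ∷ seq) (β≢𝟎 , T) bd = children β≢𝟎 n seq T bd

    split : σ ⊑⟨ β ∣ Bd ⟩ τ → (Bd [] → Jω H β σ ⊑ Jω H β τ) × (β ≢ 𝟎 → ∀ n → Child n)
    split σ≼τ = (σ≼τ [] tt) , λ β≢𝟎 n seq T → σ≼τ (n ∷ seq) (β≢𝟎 , T)

  sandwich : ∀ β → Acc _≺_ β → ∀ {Bd Bd' σr σs σt} → SegmentPair β Bd Bd' →
             σr ⊑ σs → σs ⊑ σt → σr ⊑⟨ β ∣ Bd ⟩ σt → σs ⊑⟨ β ∣ Bd' ⟩ σt → σr ⊑⟨ β ∣ Bd ⟩ σs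
  sandwich β (acc rs) {Bd} {Bd'} {σr} {σs} {σt} seg r⊑s s⊑t r≼t s≼t = r≼s
    where
    open SegmentPair seg

    child-sandwich : ∀ m → β ≢ 𝟎 → Jωn H β m σr ⊑ Jωn H β m σs → Jωn H β m σs ⊑ Jωn H β m σt →
                     Jωn H β m σr ⊑⟨ fs β m ∣ (λ p → Bd (m ∷ p)) ⟩ Jωn H β m σs
    child-sandwich m β≢𝟎 r⊑sₘ s⊑tₘ =
      sandwich (fs β m) (rs (fs-< β m β≢𝟎)) (SegmentPair-child seg m) r⊑sₘ s⊑tₘ
        (λ seq T → r≼t (m ∷ seq) (β≢𝟎 , T)) (λ seq T → s≼t (m ∷ seq) (β≢𝟎 , T))

    iterates : β ≢ 𝟎 → ∀ n seq → Bd (n ∷ seq) →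
               Jωn H β n σr ⊑ Jωn H β n σs × Jωn H β n σs ⊑ Jωn H β n σt
    iterates β≢𝟎 zero    _   _  = r⊑s , s⊑t
    iterates β≢𝟎 (suc m) seq bd with iterates β≢𝟎 m [] (weaken (sibling [] m seq bd))
    ... | r⊑sₘ , s⊑tₘ =
      child-sandwich m β≢𝟎 r⊑sₘ s⊑tₘ [] tt (weaken (sibling [] m seq bd)) ,
      s≼t (m ∷ []) (β≢𝟎 , tt) (sibling [] m seq bd)

    r≼s : σr ⊑⟨ β ∣ Bd ⟩ σs
    r≼s [] _ bd with β ≟ 𝟎
    ... | yes β≡𝟎 = Jω𝟎-sandwich β≡𝟎 r⊑s s⊑t (r≼t [] tt bd)
    ... | no β≢𝟎  = Jω-limit-⊑ β β≢𝟎 r⊑s λ j → proj₁ (iterates β≢𝟎 j [] (extend [] j β≢𝟎 bd))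
    r≼s (n ∷ seq) (β≢𝟎 , T) bd with iterates β≢𝟎 n seq bd
    ... | r⊑sₙ , s⊑tₙ = child-sandwich n β≢𝟎 r⊑sₙ s⊑tₙ seq T bd

lemma7p7 : (H : OrdPres) (E : TuringEnum) →
    let open CNF H
        open Jump E
    in
    -- uniformly computable: one decision procedure for all ξ < ω^η
    ((ξ : Ord) → Below H ξ → (s t : ℕ) → Dec (_⊴[_]_ H s ξ t)) ×
    ((ξ : Ord) → Below H ξ → (s : ℕ) → _⊴[_]_ H s ξ s) ×
    ((ξ : Ord) → Below H ξ → (r s t : ℕ) →
      _⊴[_]_ H r ξ s → _⊴[_]_ H s ξ t → _⊴[_]_ H r ξ t) ×
    ((γ ξ : Ord) → Below H γ → Below H ξ → γ ≤ᶜ ξ → (s t : ℕ) →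
      _⊴[_]_ H s ξ t → _⊴[_]_ H s γ t) ×
    -- (♣)
    ((ξ : Ord) → IsCNF ξ → (ξ +ᶜ 𝟏) <ᶜ ω^η → (r s t : ℕ) → r < s → s < t →
      _⊴[_]_ H r (ξ +ᶜ 𝟏) t → _⊴[_]_ H s ξ t → _⊴[_]_ H r (ξ +ᶜ 𝟏) s)
lemma7p7 H E = decidable , reflexive , transitive , nested , club
  where
  open OrdPres H using (η; wf)
  open CNF H
  open Jump E
  open CantorNormalForm H
  open Hierarchy E H

  decidable : (ξ : Ord) → Below H ξ → (s t : ℕ) → Dec (_⊴[_]_ H s ξ t)
  decidable ξ _ s t =
    prefix? ℕ._≟_ (∇¹ H s) (∇¹ H t) ×-dec ⊑⟨⟩? η (wf η) (λ seq → ≤ᶜ? _ _) (∇¹ H s) (∇¹ H t)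

  reflexive : (ξ : Ord) → Below H ξ → (s : ℕ) → _⊴[_]_ H s ξ s
  reflexive _ _ _ = ⊑-refl , λ _ _ _ → ⊑-refl

  transitive : (ξ : Ord) → Below H ξ → (r s t : ℕ) →
               _⊴[_]_ H r ξ s → _⊴[_]_ H s ξ t → _⊴[_]_ H r ξ t
  transitive _ _ _ _ _ (r⊑s , r≼s) (s⊑t , s≼t) =
    ⊑-trans r⊑s s⊑t , λ seq T bd → ⊑-trans (r≼s seq T bd) (s≼t seq T bd)

  nested : (γ ξ : Ord) → Below H γ → Below H ξ → γ ≤ᶜ ξ → (s t : ℕ) →
           _⊴[_]_ H s ξ t → _⊴[_]_ H s γ t
  nested _ _ _ _ γ≤ξ _ _ (s⊑t , s≼t) = s⊑t , λ seq T bd → s≼t seq T (≤ᶜ-trans bd (+𝟏-mono-≤ᶜ γ≤ξ))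

  club : (ξ : Ord) → IsCNF ξ → (ξ +ᶜ 𝟏) <ᶜ ω^η → (r s t : ℕ) → r < s → s < t →
         _⊴[_]_ H r (ξ +ᶜ 𝟏) t → _⊴[_]_ H s ξ t → _⊴[_]_ H r (ξ +ᶜ 𝟏) s
  club ξ _ _ r s t r<s _ (_ , r≼t) (s⊑t , s≼t) =
    r⊑s , sandwich η (wf η) (ordinalSegments η (ξ +ᶜ 𝟏)) r⊑s s⊑t r≼t s≼t
    where
    r⊑s : ∇¹ H r ⊑ ∇¹ H s
    r⊑s = replicate⁺ (<⇒≤ r<s) refl
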